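{- Let $m,n,s,k,c$ be positive integers such that $s$ or $k$ is odd, and let $\Gamma$ be an abelian group of order $nkc$ having exactly one involution. Then there is no $\Gamma$-magic rectangle set $\mathrm{MRS}_\Gamma(m,n;s,k;c)$.
   Context: Let $m,n,s,k,c$ be positive integers and $(\Gamma,+)$ an abelian group of order $nkc$. An $\mathrm{MRS}_\Gamma(m,n;s,k;c)$ is a set of $c$ partially filled $m\times n$ arrays (some cells may be empty) with entries in $\Gamma$ such that: (a) every element of $\Gamma$ appears exactly once and in a unique array; (b) in every array each row contains exactly $s$ filled cells and each column contains exactly $k$ filled cells; (c) there exist (not necessarily distinct) $\omega,\delta\in\Gamma$ such that, in every array, the sum of the entries of each row is $\omega$ and the sum of the entries of each column is $\delta$. An involution is an element of order $2$. -}

module Defs where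

open import Data.Nat using (ℕ; zero; suc)
open import Data.Fin using (Fin; zero; suc)
open import Data.Bool using (Bool; true; false; if_then_else_)
open import Data.Maybe using (Maybe; just; nothing; is-just; maybe)
open import Data.Product using (Σ; _×_; _,_; ∃)
open import Relation.Binary.PropositionalEquality using (_≡_; _≢_)

countF : ∀ {n} → (Fin n → Bool) → ℕ
countF {zero} p = 0
countF {suc n} p = (if p zero then 1 else 0) Data.Nat.+ countF (λ i → p (suc i))

sumF : ∀ {G : Set} → (G → G → G) → G → ∀ {n} → (Fin n → G) → G
sumF _+_ e {zero} f = e
sumF _+_ e {suc n} f = f zero + sumF _+_ e (λ i → f (suc i))

IsInvolution : {G : Set} → (G → G → G) → G → G → Set
IsInvolution _+_ e x = (x ≢ e) × (x + x ≡ e)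

HasExactlyOneInvolution : {G : Set} → (G → G → G) → G → Set
HasExactlyOneInvolution {G} _+_ e =
  Σ G λ x → IsInvolution _+_ e x × (∀ y → IsInvolution _+_ e y → y ≡ x)

-- Magic rectangle set MRS_Γ(m,n;s,k;c): c partially filled m×n arrays
-- (nothing = empty cell), indexed by Fin c.
record IsMRS {G : Set} (_+_ : G → G → G) (e : G) (m n s k c : ℕ)
             (A : Fin c → Fin m → Fin n → Maybe G) : Set where
  field
    appears : ∀ g → Σ (Fin c) λ a → Σ (Fin m) λ i → Σ (Fin n) λ j → A a i j ≡ just g
    unique  : ∀ g a i j a' i' j' → A a i j ≡ just g → A a' i' j' ≡ just g →
              (a ≡ a') × (i ≡ i') × (j ≡ j')
    rowFilled : ∀ a i → countF (λ j → is-just (A a i j)) ≡ s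
    colFilled : ∀ a j → countF (λ i → is-just (A a i j)) ≡ k
    ω δ : G
    rowSum : ∀ a i → sumF _+_ e (λ j → maybe (λ x → x) e (A a i j)) ≡ ω
    colSum : ∀ a j → sumF _+_ e (λ i → maybe (λ x → x) e (A a i j)) ≡ δ

{-# OPTIONS --safe #-}
-- The entries of an MRS are all the elements of Γ, each once, so their total T is the sum of
-- all elements of Γ.  Pairing every g with -g shows that this sum is the sum of the elements
-- of order at most 2, i.e. the unique involution t.  Counting T by rows gives T = (cm)ω and by
-- columns T = (cn)δ; since msc = nkc = |Γ| and |Γ| annihilates Γ, both sT and kT vanish.  If
-- s or k is odd this forces t = 0.
module Submission where

open import Defs
open import Data.Nat using (ℕ; _*_; NonZero)
open import Data.Nat.DivMod using (_%_)
open import Data.Fin using (Fin)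
open import Data.Maybe using (Maybe)
open import Data.Sum using (_⊎_)
open import Data.Product using (Σ)
open import Function.Bundles using (_↔_)
open import Algebra.Structures using (IsAbelianGroup)
open import Relation.Binary.PropositionalEquality using (_≡_)
open import Relation.Nullary using (¬_)

open import Level using (Level; 0ℓ)
open import Data.Nat using (zero; suc; _+_)
open import Data.Nat.Properties using (+-0-commutativeMonoid; *-comm; *-assoc)
open import Data.Fin using (zero; suc; _<_)
open import Data.Fin.Properties using (suc-injective; <-cmp; <-asym; <⇒≢; _<?_)
  renaming (_≟_ to _≟ᶠ_)
open import Data.Bool using (Bool; if_then_else_)
open import Data.Maybe using (just; nothing; maybe; is-just)
open import Data.Maybe.Properties using (just-injective)
  renaming (≡-dec to ≡-decᵐ)
open import Data.Sum using (inj₁; inj₂)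
open import Data.Product using (_×_; _,_)
open import Data.Vec.Functional using (foldr)
open import Algebra.Bundles using (Monoid; AbelianGroup)
open import Function using (_∘_; id; const)
open import Function.Bundles using (Inverse; Injection; _↣_; mk↔ₛ′)
open import Function.Construct.Composition using (_↔-∘_)
open import Function.Construct.Symmetry using (↔-sym)
open import Function.Properties.Inverse using (↔⇒↣)
open import Relation.Binary.Definitions using (DecidableEquality; tri<; tri≈; tri>)
open import Relation.Binary.PropositionalEquality
  using (_≢_; refl; sym; trans; cong; cong₂; ≢-sym; module ≡-Reasoning)
open import Relation.Nullary using (Dec; yes; no; contradiction)
open import Relation.Nullary.Decidable using (via-injection)
import Algebra.Properties.CommutativeMonoid.Sum as CommutativeMonoidSum
import Algebra.Properties.Monoid.Sum as MonoidSum
import Algebra.Properties.Monoid.Mult as MonoidMult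
import Algebra.Properties.Group as GroupProperties

sumF≡foldr : ∀ {A : Set} (_∙_ : A → A → A) (ε : A) {n} (f : Fin n → A) →
             sumF _∙_ ε f ≡ foldr _∙_ ε f
sumF≡foldr _∙_ ε {zero}  f = refl
sumF≡foldr _∙_ ε {suc n} f = cong (f zero ∙_) (sumF≡foldr _∙_ ε (f ∘ suc))

≮∧≯⇒≡ : ∀ {n} {i j : Fin n} → ¬ i < j → ¬ j < i → i ≡ j
≮∧≯⇒≡ {i = i} {j} i≮j j≮i with <-cmp i j
... | tri< i<j _ _ = contradiction i<j i≮j
... | tri≈ _ i≡j _ = i≡j
... | tri> _ _ j<i = contradiction j<i j≮i

module _ {a ℓ : Level} (M : Monoid a ℓ) where
  open Monoid M using (Carrier; _≈_; _∙_; ε; setoid; ∙-cong; ∙-congˡ; identityˡ; identityʳ)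
    renaming (trans to ≈-trans)
  open MonoidSum M using (sum; sum-cong-≋; sum-replicate-zero)
  open import Relation.Binary.Reasoning.Setoid setoid

  ∑-zero : ∀ {n} (f : Fin n → Carrier) → (∀ i → f i ≈ ε) → sum f ≈ ε
  ∑-zero {n} f f≈ε = ≈-trans (sum-cong-≋ f≈ε) (sum-replicate-zero n)

  ∑-single : ∀ {n} (f : Fin n → Carrier) i → (∀ j → j ≢ i → f j ≈ ε) → sum f ≈ f i
  ∑-single {suc n} f zero f≈ε = begin
    f zero ∙ sum (f ∘ suc) ≈⟨ ∙-congˡ (∑-zero (f ∘ suc) λ j → f≈ε (suc j) λ ()) ⟩
    f zero ∙ ε             ≈⟨ identityʳ _ ⟩
    f zero                 ∎
  ∑-single {suc n} f (suc i) f≈ε = begin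
    f zero ∙ sum (f ∘ suc) ≈⟨ ∙-cong (f≈ε zero λ ()) (∑-single (f ∘ suc) i off-i) ⟩
    ε ∙ f (suc i)          ≈⟨ identityˡ _ ⟩
    f (suc i)              ∎
    where
    off-i : ∀ j → j ≢ i → f (suc j) ≈ ε
    off-i j j≢i = f≈ε (suc j) (j≢i ∘ suc-injective)

  ∑³-single : ∀ {p q r} (F : Fin p → Fin q → Fin r → Carrier) a i j →
              (∀ a′ i′ j′ → ¬ (a′ ≡ a × i′ ≡ i × j′ ≡ j) → F a′ i′ j′ ≈ ε) →
              sum (λ a′ → sum (λ i′ → sum (λ j′ → F a′ i′ j′))) ≈ F a i j
  ∑³-single F a i j off = begin
    sum (λ a′ → sum (λ i′ → sum (F a′ i′))) ≈⟨ ∑-single _ a off-a ⟩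
    sum (λ i′ → sum (F a i′))               ≈⟨ ∑-single _ i off-i ⟩
    sum (F a i)                             ≈⟨ ∑-single _ j off-j ⟩
    F a i j                                 ∎
    where
    off-a : ∀ a′ → a′ ≢ a → sum (λ i′ → sum (F a′ i′)) ≈ ε
    off-a a′ a′≢a = ∑-zero _ λ i′ → ∑-zero _ λ j′ → off a′ i′ j′ λ (a′≡a , _) → a′≢a a′≡a
    off-i : ∀ i′ → i′ ≢ i → sum (F a i′) ≈ ε
    off-i i′ i′≢i = ∑-zero _ λ j′ → off a i′ j′ λ (_ , i′≡i , _) → i′≢i i′≡i
    off-j : ∀ j′ → j′ ≢ j → F a i j′ ≈ ε
    off-j j′ j′≢j = off a i j′ λ (_ , _ , j′≡j) → j′≢j j′≡j

module _ where
  open CommutativeMonoidSum +-0-commutativeMonoid using (sum-syntax; sum-cong-≗; ∑-comm)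
  open ≡-Reasoning

  sum-const-* : ∀ n x → ∑[ i < n ] x ≡ n * x
  sum-const-* zero    x = refl
  sum-const-* (suc n) x = cong (x +_) (sum-const-* n x)

  countF≡∑ : ∀ {n} (p : Fin n → Bool) → countF p ≡ ∑[ i < n ] (if p i then 1 else 0)
  countF≡∑ {zero}  p = refl
  countF≡∑ {suc n} p = cong ((if p zero then 1 else 0) +_) (countF≡∑ (p ∘ suc))

  doubleCounting : ∀ {m n s k} (B : Fin m → Fin n → Bool) →
                   (∀ i → countF (B i) ≡ s) → (∀ j → countF (λ i → B i j) ≡ k) →
                   m * s ≡ n * k
  doubleCounting {m} {n} {s} {k} B rows cols = begin
    m * s                                ≡⟨ sum-const-* m s ⟨
    ∑[ i < m ] s                         ≡⟨ sum-cong-≗ (λ i → trans (sym (rows i)) (countF≡∑ (B i))) ⟩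
    ∑[ i < m ] ∑[ j < n ] indicator i j  ≡⟨ ∑-comm indicator ⟩
    ∑[ j < n ] ∑[ i < m ] indicator i j  ≡⟨ sum-cong-≗ (λ j → trans (sym (countF≡∑ (λ i → B i j))) (cols j)) ⟩
    ∑[ j < n ] k                         ≡⟨ sum-const-* n k ⟩
    n * k                                ∎
    where
    indicator : Fin m → Fin n → ℕ
    indicator i j = if B i j then 1 else 0

  doubleCounting-family : ∀ {c m n s k} (B : Fin c → Fin m → Fin n → Bool) →
                          (∀ a i → countF (B a i) ≡ s) → (∀ a j → countF (λ i → B a i j) ≡ k) →
                          c * (m * s) ≡ c * (n * k)
  doubleCounting-family {c} {m} {n} {s} {k} B rows cols = begin
    c * (m * s)          ≡⟨ sum-const-* c (m * s) ⟨
    ∑[ a < c ] (m * s)   ≡⟨ sum-cong-≗ (λ a → doubleCounting (B a) (rows a) (cols a)) ⟩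
    ∑[ a < c ] (n * k)   ≡⟨ sum-const-* c (n * k) ⟩
    c * (n * k)          ∎

module AbelianGroupOnSet {G : Set} {_+_ : G → G → G} {e : G} { -_ : G → G}
                         (isAbelianGroup : IsAbelianGroup _≡_ _+_ e -_) where
  abelianGroup : AbelianGroup 0ℓ 0ℓ
  abelianGroup = record { isAbelianGroup = isAbelianGroup }

  open AbelianGroup abelianGroup public using (monoid; group; commutativeMonoid)
  open IsAbelianGroup isAbelianGroup using (assoc; comm; identityˡ; identityʳ; inverseʳ)
  open GroupProperties group
    using (⁻¹-involutive; ∙-cancelʳ; \\-leftDividesˡ; \\-leftDividesʳ; identityˡ-unique; inverseʳ-unique)
  open CommutativeMonoidSum commutativeMonoid public
    using (sum-syntax; sum-cong-≗; sum-replicate; ∑-comm; ∑-distrib-+; ∑-permute)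
  open MonoidMult monoid public using (×-assocˡ) renaming (_×_ to _·_)
  open ≡-Reasoning

  keepIf : ∀ {p} {P : Set p} → Dec P → G → G
  keepIf (yes _) x = x
  keepIf (no _)  _ = e

  keepIf-yes : ∀ {p} {P : Set p} (P? : Dec P) {x} → P → keepIf P? x ≡ x
  keepIf-yes (yes _) _  = refl
  keepIf-yes (no ¬P) hP = contradiction hP ¬P

  keepIf-no : ∀ {p} {P : Set p} (P? : Dec P) {x} → ¬ P → keepIf P? x ≡ e
  keepIf-no (yes hP) ¬P = contradiction hP ¬P
  keepIf-no (no _)   _  = refl

  odd·involution : ∀ {t} → t + t ≡ e → ∀ r → r % 2 ≡ 1 → r · t ≡ t
  odd·involution t+t≡e (suc zero)    _   = identityʳ _
  odd·involution {t} t+t≡e (suc (suc r)) odd = begin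
    t + (t + (r · t)) ≡⟨ assoc t t (r · t) ⟨
    (t + t) + (r · t) ≡⟨ cong₂ _+_ t+t≡e (odd·involution t+t≡e r odd) ⟩
    e + t             ≡⟨ identityˡ t ⟩
    t                 ∎

  translation : G → G ↔ G
  translation x = mk↔ₛ′ (x +_) ((- x) +_) (\\-leftDividesˡ x) (\\-leftDividesʳ x)

  negation : G ↔ G
  negation = mk↔ₛ′ -_ -_ ⁻¹-involutive ⁻¹-involutive

  module Enumerated {N : ℕ} (enum : Fin N ↔ G) where
    open Inverse enum using (to; from; strictlyInverseˡ; strictlyInverseʳ)

    from↣ : G ↣ Fin N
    from↣ = ↔⇒↣ (↔-sym enum)

    infix 4 _≟_
    _≟_ : DecidableEquality G
    _≟_ = via-injection from↣ _≟ᶠ_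

    ∑G : (G → G) → G
    ∑G f = ∑[ i < N ] f (to i)

    ∑G-reindex : (σ : G ↔ G) (f : G → G) → ∑G (f ∘ Inverse.to σ) ≡ ∑G f
    ∑G-reindex σ f = begin
      ∑G (f ∘ Inverse.to σ)
        ≡⟨ sum-cong-≗ {N} (λ i → cong f (strictlyInverseˡ (Inverse.to σ (to i)))) ⟨
      ∑[ i < N ] f (to (from (Inverse.to σ (to i))))
        ≡⟨ ∑-permute (f ∘ to) (↔-sym enum ↔-∘ (σ ↔-∘ enum)) ⟨
      ∑G f
        ∎

    ∑G-single : (f : G → G) (x : G) → (∀ g → g ≢ x → f g ≡ e) → ∑G f ≡ f x
    ∑G-single f x off = begin
      ∑G f            ≡⟨ ∑-single monoid (f ∘ to) (from x) off-x ⟩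
      f (to (from x)) ≡⟨ cong f (strictlyInverseˡ x) ⟩
      f x             ∎
      where
      off-x : ∀ i → i ≢ from x → f (to i) ≡ e
      off-x i i≢x = off (to i) λ i≡x → i≢x (trans (sym (strictlyInverseʳ i)) (cong from i≡x))

    N·x≡e : ∀ x → N · x ≡ e
    N·x≡e x = identityˡ-unique (N · x) (∑G id) (begin
      (N · x) + ∑G id      ≡⟨ cong (_+ ∑G id) (sum-replicate N) ⟨
      ∑G (const x) + ∑G id ≡⟨ ∑-distrib-+ (const x) to ⟨
      ∑G (x +_)            ≡⟨ ∑G-reindex (translation x) id ⟩
      ∑G id                ∎)

    selfInverse : G → G
    selfInverse g = keepIf (g ≟ - g) g

    -- The enumeration orders G; lower keeps the earlier element of each pair {g, - g}.
    lower : G → G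
    lower g = keepIf (from g <? from (- g)) g

    g+lower[-g]≡lower[g]+selfInverse[g] : ∀ g → g + lower (- g) ≡ lower g + selfInverse g
    g+lower[-g]≡lower[g]+selfInverse[g] g = begin
      g + lower (- g)
        ≡⟨ cong (λ h → g + keepIf (from (- g) <? from h) (- g)) (⁻¹-involutive g) ⟩
      g + keepIf (from (- g) <? from g) (- g)
        ≡⟨ cases (from g <? from (- g)) (from (- g) <? from g) (g ≟ - g) ⟩
      lower g + selfInverse g
        ∎
      where
      cases : (g<-g : Dec (from g < from (- g))) (-g<g : Dec (from (- g) < from g))
              (g≡-g : Dec (g ≡ - g)) →
              g + keepIf -g<g (- g) ≡ keepIf g<-g g + keepIf g≡-g g
      cases (yes g<-g) (yes -g<g) _         = contradiction -g<g (<-asym g<-g)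
      cases (yes g<-g) (no _)     (yes g≡-g) = contradiction (cong from g≡-g) (<⇒≢ g<-g)
      cases (yes _)    (no _)     (no _)    = refl
      cases (no _)     (yes -g<g) (yes g≡-g) = contradiction (cong from g≡-g) (≢-sym (<⇒≢ -g<g))
      cases (no _)     (yes _)    (no _)    = trans (inverseʳ g) (sym (identityˡ e))
      cases (no _)     (no _)     (yes _)   = comm g e
      cases (no g≮-g)  (no -g≮g)  (no g≢-g) =
        contradiction (Injection.injective from↣ (≮∧≯⇒≡ g≮-g -g≮g)) g≢-g

    ∑G-id≡∑G-selfInverse : ∑G id ≡ ∑G selfInverse
    ∑G-id≡∑G-selfInverse = ∙-cancelʳ (∑G lower) (∑G id) (∑G selfInverse) (begin
      ∑G id + ∑G lower                       ≡⟨ cong (∑G id +_) (∑G-reindex negation lower) ⟨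
      ∑G id + ∑G (lower ∘ -_)                ≡⟨ ∑-distrib-+ to (lower ∘ -_ ∘ to) ⟨
      ∑G (λ g → g + lower (- g))             ≡⟨ sum-cong-≗ (g+lower[-g]≡lower[g]+selfInverse[g] ∘ to) ⟩
      ∑G (λ g → lower g + selfInverse g)     ≡⟨ ∑-distrib-+ (lower ∘ to) (selfInverse ∘ to) ⟩
      ∑G lower + ∑G selfInverse              ≡⟨ comm (∑G lower) (∑G selfInverse) ⟩
      ∑G selfInverse + ∑G lower              ∎)

    ∑G-id≡involution : ∀ {t} → IsInvolution _+_ e t → (∀ g → IsInvolution _+_ e g → g ≡ t) →
                       ∑G id ≡ t
    ∑G-id≡involution {t} (_ , t+t≡e) unique = begin
      ∑G id           ≡⟨ ∑G-id≡∑G-selfInverse ⟩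
      ∑G selfInverse  ≡⟨ ∑G-single selfInverse t off-t ⟩
      selfInverse t   ≡⟨ keepIf-yes (t ≟ - t) (inverseʳ-unique t t t+t≡e) ⟩
      t               ∎
      where
      off-t : ∀ g → g ≢ t → selfInverse g ≡ e
      off-t g g≢t with g ≟ - g
      ... | no _ = refl
      ... | yes g≡-g with g ≟ e
      ...   | yes g≡e = g≡e
      ...   | no g≢e  = contradiction (unique g (g≢e , trans (cong (g +_) g≡-g) (inverseʳ g))) g≢t

module MagicRectangleSet
  {G : Set} {_+_ : G → G → G} {e : G} { -_ : G → G}
  (isAbelianGroup : IsAbelianGroup _≡_ _+_ e -_)
  {m n s k c : ℕ} (enum : Fin (n * k * c) ↔ G)
  {A : Fin c → Fin m → Fin n → Maybe G} (mrs : IsMRS _+_ e m n s k c A) where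

  open AbelianGroupOnSet isAbelianGroup
  open Enumerated enum
  open Inverse enum using (to)
  open IsMRS mrs
  open ≡-Reasoning

  entry : Maybe G → G
  entry = maybe id e

  entrySum : G
  entrySum = ∑[ a < c ] ∑[ i < m ] ∑[ j < n ] entry (A a i j)

  occurrence : G → Maybe G → G
  occurrence g x = keepIf (≡-decᵐ _≟_ x (just g)) g

  ∑G-occurrence : ∀ x → ∑G (λ g → occurrence g x) ≡ entry x
  ∑G-occurrence nothing  = ∑-zero monoid {n * k * c} _ (λ _ → refl)
  ∑G-occurrence (just x) = trans (∑G-single _ x off-x) (keepIf-yes (≡-decᵐ _≟_ (just x) (just x)) refl)
    where
    off-x : ∀ g → g ≢ x → occurrence g (just x) ≡ e
    off-x g g≢x = keepIf-no (≡-decᵐ _≟_ (just x) (just g)) (g≢x ∘ sym ∘ just-injective)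

  ∑cells-occurrence : ∀ g → ∑[ a < c ] ∑[ i < m ] ∑[ j < n ] occurrence g (A a i j) ≡ g
  ∑cells-occurrence g with appears g
  ... | a , i , j , Aaij≡g =
    trans (∑³-single monoid _ a i j off-aij) (keepIf-yes (≡-decᵐ _≟_ (A a i j) (just g)) Aaij≡g)
    where
    off-aij : ∀ a′ i′ j′ → ¬ (a′ ≡ a × i′ ≡ i × j′ ≡ j) → occurrence g (A a′ i′ j′) ≡ e
    off-aij a′ i′ j′ ≢aij = keepIf-no (≡-decᵐ _≟_ (A a′ i′ j′) (just g))
                                      (λ A≡g → ≢aij (unique g a′ i′ j′ a i j A≡g Aaij≡g))

  entrySum≡∑G-id : entrySum ≡ ∑G id
  entrySum≡∑G-id = begin
    entrySum
      ≡⟨ ∑-cong³ (λ a i j → ∑G-occurrence (A a i j)) ⟨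
    ∑[ a < c ] ∑[ i < m ] ∑[ j < n ] ∑[ x < N ] occ a i j x
      ≡⟨ sum-cong-≗ (λ a → sum-cong-≗ (λ i → ∑-comm (occ a i))) ⟩
    ∑[ a < c ] ∑[ i < m ] ∑[ x < N ] ∑[ j < n ] occ a i j x
      ≡⟨ sum-cong-≗ (λ a → ∑-comm (λ i x → ∑[ j < n ] occ a i j x)) ⟩
    ∑[ a < c ] ∑[ x < N ] ∑[ i < m ] ∑[ j < n ] occ a i j x
      ≡⟨ ∑-comm (λ a x → ∑[ i < m ] ∑[ j < n ] occ a i j x) ⟩
    ∑G (λ g → ∑[ a < c ] ∑[ i < m ] ∑[ j < n ] occurrence g (A a i j))
      ≡⟨ sum-cong-≗ (∑cells-occurrence ∘ to) ⟩
    ∑G id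
      ∎
    where
    N = n * k * c
    occ : Fin c → Fin m → Fin n → Fin N → G
    occ a i j x = occurrence (to x) (A a i j)
    ∑-cong³ : ∀ {F F′ : Fin c → Fin m → Fin n → G} → (∀ a i j → F a i j ≡ F′ a i j) →
              ∑[ a < c ] ∑[ i < m ] ∑[ j < n ] F a i j ≡ ∑[ a < c ] ∑[ i < m ] ∑[ j < n ] F′ a i j
    ∑-cong³ F≡F′ = sum-cong-≗ (λ a → sum-cong-≗ (λ i → sum-cong-≗ (F≡F′ a i)))

  entrySum≡[cm]·ω : entrySum ≡ (c * m) · ω
  entrySum≡[cm]·ω = begin
    entrySum                ≡⟨ sum-cong-≗ (λ a → sum-cong-≗ (λ i → row a i)) ⟩
    ∑[ a < c ] ∑[ i < m ] ω ≡⟨ sum-cong-≗ {c} (λ _ → sum-replicate m) ⟩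
    ∑[ a < c ] (m · ω)      ≡⟨ sum-replicate c ⟩
    c · (m · ω)             ≡⟨ ×-assocˡ ω c m ⟩
    (c * m) · ω             ∎
    where
    row : ∀ a i → ∑[ j < n ] entry (A a i j) ≡ ω
    row a i = trans (sym (sumF≡foldr _+_ e (λ j → entry (A a i j)))) (rowSum a i)

  entrySum≡[cn]·δ : entrySum ≡ (c * n) · δ
  entrySum≡[cn]·δ = begin
    entrySum                                          ≡⟨ sum-cong-≗ (λ a → ∑-comm (λ i j → entry (A a i j))) ⟩
    ∑[ a < c ] ∑[ j < n ] ∑[ i < m ] entry (A a i j)  ≡⟨ sum-cong-≗ (λ a → sum-cong-≗ (λ j → column a j)) ⟩
    ∑[ a < c ] ∑[ j < n ] δ                           ≡⟨ sum-cong-≗ {c} (λ _ → sum-replicate n) ⟩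
    ∑[ a < c ] (n · δ)                                ≡⟨ sum-replicate c ⟩
    c · (n · δ)                                       ≡⟨ ×-assocˡ δ c n ⟩
    (c * n) · δ                                       ∎
    where
    column : ∀ a j → ∑[ i < m ] entry (A a i j) ≡ δ
    column a j = trans (sym (sumF≡foldr _+_ e (λ i → entry (A a i j)))) (colSum a j)

  s·entrySum≡e : s · entrySum ≡ e
  s·entrySum≡e = begin
    s · entrySum        ≡⟨ cong (s ·_) entrySum≡[cm]·ω ⟩
    s · ((c * m) · ω)   ≡⟨ ×-assocˡ ω s (c * m) ⟩
    (s * (c * m)) · ω   ≡⟨ cong (_· ω) s*cm≡nkc ⟩
    (n * k * c) · ω     ≡⟨ N·x≡e ω ⟩
    e                   ∎
    where
    s*cm≡nkc : s * (c * m) ≡ n * k * c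
    s*cm≡nkc = begin
      s * (c * m)  ≡⟨ *-comm s (c * m) ⟩
      c * m * s    ≡⟨ *-assoc c m s ⟩
      c * (m * s)  ≡⟨ doubleCounting-family (λ a i j → is-just (A a i j)) rowFilled colFilled ⟩
      c * (n * k)  ≡⟨ *-comm c (n * k) ⟩
      n * k * c    ∎

  k·entrySum≡e : k · entrySum ≡ e
  k·entrySum≡e = begin
    k · entrySum        ≡⟨ cong (k ·_) entrySum≡[cn]·δ ⟩
    k · ((c * n) · δ)   ≡⟨ ×-assocˡ δ k (c * n) ⟩
    (k * (c * n)) · δ   ≡⟨ cong (_· δ) k*cn≡nkc ⟩
    (n * k * c) · δ     ≡⟨ N·x≡e δ ⟩
    e                   ∎
    where
    k*cn≡nkc : k * (c * n) ≡ n * k * c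
    k*cn≡nkc = begin
      k * (c * n)  ≡⟨ *-comm k (c * n) ⟩
      c * n * k    ≡⟨ *-assoc c n k ⟩
      c * (n * k)  ≡⟨ *-comm c (n * k) ⟩
      n * k * c    ∎

corollary3p7 : (m n s k c : ℕ) → NonZero m → NonZero n → NonZero s → NonZero k → NonZero c →
    (s % 2 ≡ 1) ⊎ (k % 2 ≡ 1) →
    (G : Set) (_+_ : G → G → G) (e : G) (-_ : G → G) →
    IsAbelianGroup _≡_ _+_ e -_ →
    (Fin (n * k * c) ↔ G) →
    HasExactlyOneInvolution _+_ e →
    ¬ (Σ (Fin c → Fin m → Fin n → Maybe G) λ A → IsMRS _+_ e m n s k c A)
corollary3p7 m n s k c _ _ _ _ _ s∨k-odd G _+_ e -_ isAbelianGroup enum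
             (t , involution@(t≢e , t+t≡e) , unique) (A , mrs) = t≢e (t≡e s∨k-odd)
  where
  open AbelianGroupOnSet isAbelianGroup using (_·_; odd·involution)
  open AbelianGroupOnSet.Enumerated isAbelianGroup enum using (∑G-id≡involution)
  open MagicRectangleSet isAbelianGroup enum mrs
  open ≡-Reasoning

  entrySum≡t : entrySum ≡ t
  entrySum≡t = trans entrySum≡∑G-id (∑G-id≡involution involution unique)

  odd·entrySum≡e⇒t≡e : ∀ r → r % 2 ≡ 1 → r · entrySum ≡ e → t ≡ e
  odd·entrySum≡e⇒t≡e r r-odd r·entrySum≡e = begin
    t             ≡⟨ odd·involution t+t≡e r r-odd ⟨
    r · t         ≡⟨ cong (r ·_) entrySum≡t ⟨
    r · entrySum  ≡⟨ r·entrySum≡e ⟩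
    e             ∎

  t≡e : (s % 2 ≡ 1) ⊎ (k % 2 ≡ 1) → t ≡ e
  t≡e (inj₁ s-odd) = odd·entrySum≡e⇒t≡e s s-odd s·entrySum≡e
  t≡e (inj₂ k-odd) = odd·entrySum≡e⇒t≡e k k-odd k·entrySum≡e
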